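{- Let $P$ be a nonempty set and ${\rm cl}$ a closure operation on $P$ which is proper (i.e. does not satisfy the exchange axiom) and totally degenerated. Then: (i) For $x,y\in P$, ${\mathcal E}(x)={\mathcal E}(y)$ holds if and only if ${\rm cl}(x)={\rm cl}(y)$; and $P_{\rm cl}$ is a partition of $P\smallsetminus{\rm cl}(\emptyset)$. (ii) The map ${\mathcal E}(x)\mapsto{\rm cl}(x)$ is an isomorphism of linear orders between $\mathbb P_{\rm cl}=(P_{\rm cl},\leq_{\rm cl})$ and $(\{{\rm cl}(x)\mid x\in P\smallsetminus{\rm cl}(\emptyset)\},\subseteq)$ (in particular both are linear orders). (iii) For every $X\subseteq P$, ${\rm cl}(X)={\rm cl}(\emptyset)\cup\bigcup\{{\mathcal E}(y)\mid y\in P\smallsetminus{\rm cl}(\emptyset),\ \exists x\in X\smallsetminus{\rm cl}(\emptyset)\ \pi(y)\leq_{\rm cl}\pi(x)\}$.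
   Context: A closure operation on a set $P$ is a map ${\rm cl}$ on subsets of $P$ such that: $X\subseteq Y$ implies $X\subseteq{\rm cl}(X)\subseteq{\rm cl}(Y)$; ${\rm cl}(X)$ is the union of ${\rm cl}(X_0)$ over finite $X_0\subseteq X$; and ${\rm cl}({\rm cl}(X))={\rm cl}(X)$. The exchange axiom is: $b\in{\rm cl}(Xa)\smallsetminus{\rm cl}(X)$ implies $a\in{\rm cl}(Xb)$. ${\rm cl}$ is totally degenerated if for every finite nonempty $X\subseteq P$ there is $x\in X$ with ${\rm cl}(X)={\rm cl}(x)$. For $x,y\in P$: $x\leq_{\rm cl}y$ iff ${\rm cl}(x)\subseteq{\rm cl}(y)$; for subsets, $X\leq_{\rm cl}Y$ iff $x\leq_{\rm cl}y$ for all $x\in X,y\in Y$. ${\mathcal E}(x)=\{y\in P\mid{\rm cl}(x)={\rm cl}(y)\}$; $P_{\rm cl}=\{{\mathcal E}(x)\mid x\in P\smallsetminus{\rm cl}(\emptyset)\}$; $\pi:P\smallsetminus{\rm cl}(\emptyset)\to P_{\rm cl}$ is $\pi(x)={\mathcal E}(x)$. -}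

module Defs where

open import Level using (0ℓ)
open import Data.Product using (Σ; ∃; ∃-syntax; _×_; _,_)
open import Data.List using (List; [])
open import Data.List.Relation.Unary.All using (All)
open import Data.List.Membership.Propositional using () renaming (_∈_ to _∈ₗ_)
open import Relation.Unary using (Pred; _∈_; _∉_; _⊆_; _≐_; ∅; ｛_｝; _∪_)
open import Relation.Nullary using (¬_)
open import Relation.Binary.PropositionalEquality using (_≡_)

fromList : {P : Set} → List P → Pred P 0ℓ
fromList xs = λ y → y ∈ₗ xs

record IsClosureOperation {P : Set} (cl : Pred P 0ℓ → Pred P 0ℓ) : Set₁ where
  field
    extensive : ∀ (X : Pred P 0ℓ) → X ⊆ cl X
    monotone  : ∀ (X Y : Pred P 0ℓ) → X ⊆ Y → cl X ⊆ cl Y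
    finitary  : ∀ (X : Pred P 0ℓ) →
                cl X ≐ (λ z → ∃[ xs ] (All (_∈ X) xs × z ∈ cl (fromList xs)))
    idempotent : ∀ (X : Pred P 0ℓ) → cl (cl X) ≐ cl X

module _ {P : Set} (cl : Pred P 0ℓ → Pred P 0ℓ) where

  clₚ : P → Pred P 0ℓ
  clₚ x = cl ｛ x ｝

  Exchange : Set₁
  Exchange = ∀ (X : Pred P 0ℓ) (a b : P) →
             b ∈ cl (X ∪ ｛ a ｝) → b ∉ cl X → a ∈ cl (X ∪ ｛ b ｝)

  Proper : Set₁
  Proper = ¬ Exchange

  TotallyDegenerated : Set
  TotallyDegenerated = ∀ (xs : List P) → ¬ (xs ≡ []) →
                       ∃[ x ] (x ∈ₗ xs × cl (fromList xs) ≐ clₚ x)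

  _≤cl_ : P → P → Set
  x ≤cl y = clₚ x ⊆ clₚ y

  _≤clˢ_ : Pred P 0ℓ → Pred P 0ℓ → Set
  X ≤clˢ Y = ∀ {x y} → x ∈ X → y ∈ Y → x ≤cl y

  𝓔 : P → Pred P 0ℓ
  𝓔 x = λ y → clₚ x ≐ clₚ y

  NonLoop : Pred P 0ℓ
  NonLoop = λ x → x ∉ cl ∅

  -- Elements of P ∖ cl(∅), used as representatives x of the blocks 𝓔(x) ∈ P_cl
  -- (and of the sets cl(x)).
  Rep : Set
  Rep = Σ P NonLoop

  π : Rep → Pred P 0ℓ
  π (x , _) = 𝓔 x

  -- P_cl presented as a setoid: representative x stands for 𝓔(x),
  -- equality is equality of the sets 𝓔(x), order is ≤cl on subsets.
  _≈ᴾ_ : Rep → Rep → Set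
  r ≈ᴾ s = π r ≐ π s

  _≤ᴾ_ : Rep → Rep → Set
  r ≤ᴾ s = π r ≤clˢ π s

  -- {cl(x) | x ∈ P ∖ cl(∅)} presented as a setoid: x stands for cl(x),
  -- equality is equality of sets, order is ⊆.
  clRep : Rep → Pred P 0ℓ
  clRep (x , _) = clₚ x

  _≈ᶜ_ : Rep → Rep → Set
  r ≈ᶜ s = clRep r ≐ clRep s

  _≤ᶜ_ : Rep → Rep → Set
  r ≤ᶜ s = clRep r ⊆ clRep s

  𝓔↦cl : Rep → Rep
  𝓔↦cl r = r

  RHS : Pred P 0ℓ → Pred P 0ℓ
  RHS X = cl ∅ ∪ (λ z → ∃[ y ] ∃[ x ] Σ (y ∈ NonLoop) λ hy → Σ (x ∈ X) λ _ →
            Σ (x ∈ NonLoop) λ hx → (π (y , hy) ≤clˢ π (x , hx)) × z ∈ 𝓔 y)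

record IsPartition {P : Set} {I : Set} (B : I → Pred P 0ℓ) (S : Pred P 0ℓ) : Set where
  field
    nonempty : ∀ i → ∃[ z ] z ∈ B i
    inside   : ∀ i → B i ⊆ S
    cover    : ∀ {z} → z ∈ S → ∃[ i ] z ∈ B i
    disjointOrEqual : ∀ i j → (∃[ z ] (z ∈ B i × z ∈ B j)) → B i ≐ B j

-- Total degeneracy makes the sets cl(x) a chain and, for every X, makes cl(X) the union
-- of cl(∅) with the cl(x), x ∈ X: a finite X₀ ⊆ X generating a point of cl(X) has a single
-- element x with cl(X₀) = cl(x).  Everything else is bookkeeping with the blocks 𝓔(x),
-- which are the fibres of x ↦ cl(x).
module Submission where

open import Defs
open import Level using (0ℓ)
open import Data.Product using (∃-syntax; _×_; _,_; proj₁; proj₂)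
open import Data.Sum using (_⊎_; inj₁; inj₂)
open import Data.List using ([]; _∷_)
open import Data.List.Relation.Unary.All using (lookup)
open import Data.List.Relation.Unary.Any using (here; there)
open import Data.Empty using (⊥-elim)
open import Relation.Nullary using (yes; no)
open import Relation.Binary.PropositionalEquality using (refl)
open import Relation.Unary using (Pred; _∈_; _∉_; _⊆_; _≐_; ∅; ｛_｝)
open import Relation.Unary.Properties using (≐-refl; ≐-sym; ≐-trans)
open import Relation.Unary.Relation.Binary.Subset using (⊆-isPartialOrder)
open import Relation.Binary.Structures using (IsTotalOrder)
open import Relation.Binary.Morphism.Structures using (IsOrderIsomorphism)
import Relation.Binary.Construct.On as On
import Relation.Binary.Morphism.OrderMonomorphism as OrderMonomorphism
open import Function.Bundles using (_⇔_; mk⇔; Equivalence)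
open import Axiom.ExcludedMiddle using (ExcludedMiddle)

module _ {P : Set} (cl : Pred P 0ℓ → Pred P 0ℓ) where

  𝓔≐𝓔⇔clₚ≐clₚ : (x y : P) → (𝓔 cl x ≐ 𝓔 cl y) ⇔ (clₚ cl x ≐ clₚ cl y)
  𝓔≐𝓔⇔clₚ≐clₚ x y = mk⇔
    (λ 𝓔x≐𝓔y → ≐-sym (proj₁ 𝓔x≐𝓔y {x} ≐-refl))
    (λ x≐y → (λ {_} → ≐-trans (≐-sym x≐y)) , (λ {_} → ≐-trans x≐y))

  ≈ᴾ⇒≈ᶜ : ∀ r s → _≈ᴾ_ cl r s → _≈ᶜ_ cl r s
  ≈ᴾ⇒≈ᶜ (x , _) (y , _) = Equivalence.to (𝓔≐𝓔⇔clₚ≐clₚ x y)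

  ≈ᶜ⇒≈ᴾ : ∀ r s → _≈ᶜ_ cl r s → _≈ᴾ_ cl r s
  ≈ᶜ⇒≈ᴾ (x , _) (y , _) = Equivalence.from (𝓔≐𝓔⇔clₚ≐clₚ x y)

  ≤ᴾ⇒≤ᶜ : ∀ r s → _≤ᴾ_ cl r s → _≤ᶜ_ cl r s
  ≤ᴾ⇒≤ᶜ (x , _) (y , _) x≤y = x≤y ≐-refl ≐-refl

  ≤ᶜ⇒≤ᴾ : ∀ r s → _≤ᶜ_ cl r s → _≤ᴾ_ cl r s
  ≤ᶜ⇒≤ᴾ (_ , _) (_ , _) x⊆y (_ , x′⊆x) (y⊆y′ , _) = λ z∈x′ → y⊆y′ (x⊆y (x′⊆x z∈x′))

  𝓔↦cl-isOrderIsomorphism : IsOrderIsomorphism (_≈ᴾ_ cl) (_≈ᶜ_ cl) (_≤ᴾ_ cl) (_≤ᶜ_ cl) (𝓔↦cl cl)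
  𝓔↦cl-isOrderIsomorphism = record
    { isOrderMonomorphism = record
      { isOrderHomomorphism = record
        { cong = λ {r} {s} → ≈ᴾ⇒≈ᶜ r s
        ; mono = λ {r} {s} → ≤ᴾ⇒≤ᶜ r s
        }
      ; injective = λ {r} {s} → ≈ᶜ⇒≈ᴾ r s
      ; cancel    = λ {r} {s} → ≤ᶜ⇒≤ᴾ r s
      }
    ; surjective = λ s → s , λ {r} → ≈ᴾ⇒≈ᶜ r s
    }

module ClosureOperation {P : Set} {cl : Pred P 0ℓ → Pred P 0ℓ}
                        (isClosure : IsClosureOperation cl) where
  open IsClosureOperation isClosure

  ∈-clₚ : ∀ x → x ∈ clₚ cl x
  ∈-clₚ x = extensive ｛ x ｝ refl

  ∈⇒clₚ⊆cl : ∀ X {a} → a ∈ X → clₚ cl a ⊆ cl X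
  ∈⇒clₚ⊆cl X {a} a∈X = monotone ｛ a ｝ X (λ { refl → a∈X })

  ∈-cl⇒clₚ⊆cl : ∀ X {a} → a ∈ cl X → clₚ cl a ⊆ cl X
  ∈-cl⇒clₚ⊆cl X a∈clX z∈cla = proj₁ (idempotent X) (∈⇒clₚ⊆cl (cl X) a∈clX z∈cla)

  cl∅⊆cl : ∀ X → cl ∅ ⊆ cl X
  cl∅⊆cl X = monotone ∅ X (λ ())

  π-isPartition : IsPartition (π cl) (NonLoop cl)
  π-isPartition = record
    { nonempty = λ { (x , _) → x , ≐-refl }
    ; inside   = λ { (x , x∉cl∅) x≐z z∈cl∅ →
                     x∉cl∅ (∈-cl⇒clₚ⊆cl ∅ z∈cl∅ (proj₁ x≐z (∈-clₚ x))) }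
    ; cover    = λ z∉cl∅ → (_ , z∉cl∅) , ≐-refl
    ; disjointOrEqual = λ { (x , _) (y , _) (_ , x≐z , y≐z) →
        Equivalence.from (𝓔≐𝓔⇔clₚ≐clₚ cl x y) (≐-trans x≐z (≐-sym y≐z)) }
    }

  module _ (degenerated : TotallyDegenerated cl) where

    clₚ-total : ∀ x y → (clₚ cl x ⊆ clₚ cl y) ⊎ (clₚ cl y ⊆ clₚ cl x)
    clₚ-total x y with degenerated (x ∷ y ∷ []) (λ ())
    ... | _ , here refl , cl≐x =
      inj₂ (λ z∈cly → proj₁ cl≐x (∈⇒clₚ⊆cl _ (there (here refl)) z∈cly))
    ... | _ , there (here refl) , cl≐y =
      inj₁ (λ z∈clx → proj₁ cl≐y (∈⇒clₚ⊆cl _ (here refl) z∈clx))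

    ∈-cl⇒∈-cl∅⊎∈-clₚ : ∀ X {z} → z ∈ cl X → z ∈ cl ∅ ⊎ ∃[ x ] (x ∈ X × z ∈ clₚ cl x)
    ∈-cl⇒∈-cl∅⊎∈-clₚ X z∈clX with proj₁ (finitary X) z∈clX
    ... | [] , _ , z∈cl[] = inj₁ (monotone (fromList []) ∅ (λ ()) z∈cl[])
    ... | xs@(_ ∷ _) , xs⊆X , z∈clxs with degenerated xs (λ ())
    ... | x , x∈xs , clxs≐x = inj₂ (x , lookup xs⊆X x∈xs , proj₁ clxs≐x z∈clxs)

    clₚ-isTotalOrder : IsTotalOrder (_≈ᶜ_ cl) (_≤ᶜ_ cl)
    clₚ-isTotalOrder = record
      { isPartialOrder = On.isPartialOrder (clRep cl) ⊆-isPartialOrder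
      ; total          = λ { (x , _) (y , _) → clₚ-total x y }
      }

    𝓔-isTotalOrder : IsTotalOrder (_≈ᴾ_ cl) (_≤ᴾ_ cl)
    𝓔-isTotalOrder = OrderMonomorphism.isTotalOrder
      (IsOrderIsomorphism.isOrderMonomorphism (𝓔↦cl-isOrderIsomorphism cl)) clₚ-isTotalOrder

    RHS⊆cl : ∀ X → RHS cl X ⊆ cl X
    RHS⊆cl X (inj₁ z∈cl∅) = cl∅⊆cl X z∈cl∅
    RHS⊆cl X (inj₂ (_ , x , _ , x∈X , _ , y≤x , y≐z)) =
      ∈-cl⇒clₚ⊆cl X (extensive X x∈X) (y≤x ≐-refl ≐-refl (proj₂ y≐z (∈-clₚ _)))

    -- Excluded middle decides whether z is a loop; otherwise z itself represents its block.
    cl⊆RHS : ExcludedMiddle 0ℓ → ∀ X → cl X ⊆ RHS cl X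
    cl⊆RHS em X {z} z∈clX with em {z ∈ cl ∅}
    ... | yes z∈cl∅ = inj₁ z∈cl∅
    ... | no z∉cl∅ with ∈-cl⇒∈-cl∅⊎∈-clₚ X z∈clX
    ... | inj₁ z∈cl∅ = ⊥-elim (z∉cl∅ z∈cl∅)
    ... | inj₂ (x , x∈X , z∈clx) =
      inj₂ (z , x , z∉cl∅ , x∈X , x∉cl∅ , z≤x , ≐-refl)
      where
      x∉cl∅ : x ∉ cl ∅
      x∉cl∅ x∈cl∅ = z∉cl∅ (∈-cl⇒clₚ⊆cl ∅ x∈cl∅ z∈clx)
      z≤x : _≤clˢ_ cl (𝓔 cl z) (𝓔 cl x)
      z≤x = ≤ᶜ⇒≤ᴾ cl (z , z∉cl∅) (x , x∉cl∅) (∈-cl⇒clₚ⊆cl ｛ x ｝ z∈clx)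

proposition1p4 : ExcludedMiddle 0ℓ →
    (P : Set) (p₀ : P) (cl : Pred P 0ℓ → Pred P 0ℓ) →
    IsClosureOperation cl → Proper cl → TotallyDegenerated cl →
    ((x y : P) → (𝓔 cl x ≐ 𝓔 cl y) ⇔ (clₚ cl x ≐ clₚ cl y))
    × IsPartition (π cl) (NonLoop cl)
    × IsTotalOrder (_≈ᴾ_ cl) (_≤ᴾ_ cl)
    × IsTotalOrder (_≈ᶜ_ cl) (_≤ᶜ_ cl)
    × IsOrderIsomorphism (_≈ᴾ_ cl) (_≈ᶜ_ cl) (_≤ᴾ_ cl) (_≤ᶜ_ cl) (𝓔↦cl cl)
    × ((X : Pred P 0ℓ) → cl X ≐ RHS cl X)
proposition1p4 em _ _ cl isClosure _ degenerated =
    𝓔≐𝓔⇔clₚ≐clₚ cl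
  , π-isPartition
  , 𝓔-isTotalOrder degenerated
  , clₚ-isTotalOrder degenerated
  , 𝓔↦cl-isOrderIsomorphism cl
  , λ X → cl⊆RHS degenerated em X , RHS⊆cl degenerated X
  where open ClosureOperation isClosure
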